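{- Let $G$ be a finite, simple, connected graph, let $d\ge1$, and let $x_0\sim x_1\sim\dots\sim x_d$ be a path in $G$ (consecutive vertices adjacent) with $d_G(x_0,x_d)=d$. For $1\le i\le d$ let $H_i$ be a maximal clique of $G$ containing $\{x_{i-1},x_i\}$. Then $H_1\sim H_2\sim\dots\sim H_d$ in the clique graph $\Gamma(G)$ and $d_{\Gamma(G)}(H_1,H_d)=d-1$. Hence $H_1\sim\dots\sim H_d$ is a shortest path in $\Gamma(G)$ connecting $H_1$ and $H_d$, and $H_1,\dots,H_d$ are mutually distinct.
   Context: $d_G$ denotes graph distance in $G$. A clique is a nonempty vertex subset inducing a complete graph; a maximal clique is one maximal under inclusion. The clique graph $\Gamma(G)$ has as vertices the maximal cliques of $G$, with two maximal cliques $H_1,H_2$ adjacent (written $H_1\sim H_2$) iff $H_1\neq H_2$ and $H_1\cap H_2\neq\emptyset$; $d_{\Gamma(G)}$ is its graph distance. -}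

module Defs where

open import Data.Nat using (ℕ; zero; suc; _≤_)
open import Data.Bool using (Bool; true; false; T)
open import Data.Fin using (Fin)
open import Data.Fin.Subset using (Subset; _∈_; _⊆_; _∩_; Nonempty)
open import Data.Product using (Σ; ∃; _×_)
open import Relation.Binary.PropositionalEquality using (_≡_; _≢_)

record Graph : Set where
  field
    n     : ℕ
    adj   : Fin n → Fin n → Bool
    sym   : ∀ u v → adj u v ≡ adj v u
    irrefl : ∀ v → adj v v ≡ false

  Adj : Fin n → Fin n → Set
  Adj u v = T (adj u v)

data Walk {A : Set} (R : A → A → Set) : A → A → ℕ → Set where
  nil  : ∀ {a} → Walk R a a 0
  step : ∀ {a b c k} → R a b → Walk R b c k → Walk R a c (suc k)

Dist : {A : Set} → (A → A → Set) → A → A → ℕ → Set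
Dist R a b d = Walk R a b d × (∀ k → Walk R a b k → d ≤ k)

module _ (G : Graph) where
  open Graph G

  Connected : Set
  Connected = ∀ u v → ∃ λ k → Walk Adj u v k

  IsClique : Subset n → Set
  IsClique K = Nonempty K × (∀ u v → u ∈ K → v ∈ K → u ≢ v → Adj u v)

  IsMaximalClique : Subset n → Set
  IsMaximalClique H = IsClique H × (∀ K → IsClique K → H ⊆ K → K ≡ H)

  ΓAdj : Subset n → Subset n → Set
  ΓAdj H K = IsMaximalClique H × IsMaximalClique K × H ≢ K
           × Nonempty (H ∩ K)

-- On a geodesic x₀ … x_d, two vertices x_a and x_b with b ≥ a + 2 are neither equal nor
-- adjacent: otherwise cutting out the stretch between them gives a walk from x₀ to x_d of
-- length a + 1 + (d − b) < d. Hence x_{i−1} ∈ H_i and x_j ∈ H_j prevent H_i = H_j for i < j,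
-- and consecutive H_i, H_{i+1} share x_i. Conversely a walk of length k in Γ(G) from H₁ to
-- H_d, read through the cliques it visits, yields a walk of length at most k + 1 from x₀ to
-- x_d in G, so d − 1 ≤ k.
{-# OPTIONS --safe #-}
module Submission where

open import Defs
open import Data.Nat using (ℕ; zero; suc; _≤_; _<_; _∸_; _+_; z≤n; s≤s; s≤s⁻¹)
open import Data.Nat.Properties
  using (≤-refl; ≤-trans; <⇒≤; <⇒≱; <-≤-trans; <-cmp; m≤n⇒m≤1+n; m≤n+m; +-suc; +-monoˡ-<;
         m∸n+n≡m; m+[n∸m]≡n; m≤o∸n⇒m+n≤o; module ≤-Reasoning)
open import Data.Fin using (Fin; _≟_)
open import Data.Fin.Subset using (Subset; _∈_)
open import Data.Fin.Subset.Properties using (x∈p∩q⁺; x∈p∩q⁻)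
open import Data.Product using (_×_; _,_; proj₁; ∃)
open import Data.Empty using (⊥)
open import Relation.Nullary using (¬_; yes; no)
open import Relation.Binary using (tri<; tri≈; tri>)
open import Relation.Binary.Construct.Closure.Reflexive using (ReflClosure; refl; [_])
open import Relation.Binary.PropositionalEquality using (_≢_; refl; sym; subst)

module _ {A : Set} {R : A → A → Set} where

  _++ʷ_ : ∀ {a b c k m} → Walk R a b k → Walk R b c m → Walk R a c (k + m)
  nil      ++ʷ q = q
  step r p ++ʷ q = step r (p ++ʷ q)

  Walk-map : ∀ {S : A → A → Set} → (∀ {a b} → R a b → S a b) →
             ∀ {a b k} → Walk R a b k → Walk S a b k
  Walk-map f nil        = nil
  Walk-map f (step r p) = step (f r) (Walk-map f p)

module _ {A : Set} {R : A → A → Set} where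

  Walk-dropRefl : ∀ {a b k} → Walk (ReflClosure R) a b k → ∃ λ m → m ≤ k × Walk R a b m
  Walk-dropRefl nil = 0 , z≤n , nil
  Walk-dropRefl (step refl p) with Walk-dropRefl p
  ... | m , m≤k , q = m , m≤n⇒m≤1+n m≤k , q
  Walk-dropRefl (step [ r ] p) with Walk-dropRefl p
  ... | m , m≤k , q = suc m , s≤s m≤k , step r q

  Dist-≤-reflWalk : ∀ {a b d k} → Dist R a b d → Walk (ReflClosure R) a b k → d ≤ k
  Dist-≤-reflWalk (_ , minimal) p with Walk-dropRefl p
  ... | m , m≤k , q = ≤-trans (minimal m q) m≤k

  sequenceWalk : (f : ℕ → A) (m : ℕ) → (∀ i → i < m → R (f i) (f (suc i))) →
                 Walk R (f 0) (f m) m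
  sequenceWalk f zero    _     = nil
  sequenceWalk f (suc m) steps =
    step (steps 0 (s≤s z≤n))
         (sequenceWalk (λ i → f (suc i)) m λ i i<m → steps (suc i) (s≤s i<m))

  module Geodesic {d : ℕ} (x : ℕ → A) (steps : ∀ i → i < d → R (x i) (x (suc i)))
                  (geodesic : Dist R (x 0) (x d) d) where

    prefixWalk : ∀ {a} → a ≤ d → Walk R (x 0) (x a) a
    prefixWalk {a} a≤d = sequenceWalk x a λ i i<a → steps i (<-≤-trans i<a a≤d)

    -- Shifting by i ↦ i + b (not b + i) keeps suc (i + b) ≡ suc i + b definitional.
    suffixWalk : ∀ {b} → b ≤ d → Walk R (x b) (x d) (d ∸ b)
    suffixWalk {b} b≤d =
      subst (λ v → Walk R (x b) (x v) (d ∸ b)) (m∸n+n≡m b≤d)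
        (sequenceWalk (λ i → x (i + b)) (d ∸ b) λ i i<d∸b →
          steps (i + b) (m≤o∸n⇒m+n≤o (suc i) b≤d i<d∸b))

    shortcut-shorter : ∀ {a b} → 2 + a ≤ b → b ≤ d → a + suc (d ∸ b) < d
    shortcut-shorter {a} {b} a+2≤b b≤d = begin-strict
      a + suc (d ∸ b)  ≡⟨ +-suc a (d ∸ b) ⟩
      suc a + (d ∸ b)  <⟨ +-monoˡ-< (d ∸ b) a+2≤b ⟩
      b + (d ∸ b)      ≡⟨ m+[n∸m]≡n b≤d ⟩
      d                ∎
      where open ≤-Reasoning

    no-shortcut : ∀ {a b} → 2 + a ≤ b → b ≤ d → ¬ ReflClosure R (x a) (x b)
    no-shortcut {a} {b} a+2≤b b≤d r =
      <⇒≱ (shortcut-shorter a+2≤b b≤d) (Dist-≤-reflWalk geodesic shortcut)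
      where
      shortcut : Walk (ReflClosure R) (x 0) (x d) (a + suc (d ∸ b))
      shortcut = Walk-map [_] (prefixWalk (≤-trans (m≤n+m a 2) (≤-trans a+2≤b b≤d)))
                 ++ʷ step r (Walk-map [_] (suffixWalk b≤d))

module _ (G : Graph) where
  open Graph G using (Adj)

  clique-reflAdj : ∀ {K u v} → IsClique G K → u ∈ K → v ∈ K → ReflClosure Adj u v
  clique-reflAdj {u = u} {v} (_ , complete) u∈K v∈K with u ≟ v
  ... | yes refl = refl
  ... | no  u≢v  = [ complete u v u∈K v∈K u≢v ]

  ΓWalk⇒reflWalk : ∀ {K L k} → IsClique G K → Walk (ΓAdj G) K L k →
                   ∀ {u v} → u ∈ K → v ∈ L → Walk (ReflClosure Adj) u v (suc k)
  ΓWalk⇒reflWalk clique nil u∈K v∈L = step (clique-reflAdj clique u∈K v∈L) nil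
  ΓWalk⇒reflWalk {K} clique (step {b = K′} (_ , (clique′ , _) , _ , (w , w∈K∩K′)) p) u∈K v∈L
    with x∈p∩q⁻ K K′ w∈K∩K′
  ... | w∈K , w∈K′ =
    step (clique-reflAdj clique u∈K w∈K) (ΓWalk⇒reflWalk clique′ p w∈K′ v∈L)

lemma3p4 : (G : Graph) → Connected G → (d : ℕ) → 1 ≤ d
    → (x : ℕ → Fin (Graph.n G))
    → (∀ i → i < d → Graph.Adj G (x i) (x (suc i)))
    → Dist (Graph.Adj G) (x 0) (x d) d
    → (H : ℕ → Subset (Graph.n G))
    → (∀ i → 1 ≤ i → i ≤ d → IsMaximalClique G (H i) × x (i ∸ 1) ∈ H i × x i ∈ H i)
    → (∀ i → 1 ≤ i → i < d → ΓAdj G (H i) (H (suc i)))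
    × Dist (ΓAdj G) (H 1) (H d) (d ∸ 1)
    × (∀ i j → 1 ≤ i → i ≤ d → 1 ≤ j → j ≤ d → i ≢ j → H i ≢ H j)
lemma3p4 G _ d@(suc d′) (s≤s _) x steps geodesic H cliques =
  consecutive , (sequenceWalk (λ i → H (suc i)) d′ consecutive′ , minimal) , distinct
  where
  open Geodesic x steps geodesic using (no-shortcut)

  separated : ∀ {a b K} → 2 + a ≤ b → b ≤ d → IsClique G K → x a ∈ K → x b ∈ K → ⊥
  separated a+2≤b b≤d clique xa∈K xb∈K =
    no-shortcut a+2≤b b≤d (clique-reflAdj G clique xa∈K xb∈K)

  consecutive : ∀ i → 1 ≤ i → i < d → ΓAdj G (H i) (H (suc i))
  consecutive (suc i) _ i<d
    with cliques (suc i) (s≤s z≤n) (<⇒≤ i<d) | cliques (suc (suc i)) (s≤s z≤n) i<d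
  ... | max , xi∈H , xi+1∈H | max′ , xi+1∈H′ , xi+2∈H′ =
    max , max′ , H≢H′ , (x (suc i) , x∈p∩q⁺ (xi+1∈H , xi+1∈H′))
    where
    H≢H′ : H (suc i) ≢ H (suc (suc i))
    H≢H′ H≡H′ = separated ≤-refl i<d (proj₁ max) xi∈H (subst (x (2 + i) ∈_) (sym H≡H′) xi+2∈H′)

  consecutive′ : ∀ i → i < d′ → ΓAdj G (H (suc i)) (H (suc (suc i)))
  consecutive′ i i<d′ = consecutive (suc i) (s≤s z≤n) (s≤s i<d′)

  minimal : ∀ k → Walk (ΓAdj G) (H 1) (H d) k → d′ ≤ k
  minimal k p with cliques 1 ≤-refl (s≤s z≤n) | cliques d (s≤s z≤n) ≤-refl
  ... | max , x0∈H1 , _ | _ , _ , xd∈Hd =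
    s≤s⁻¹ (Dist-≤-reflWalk geodesic (ΓWalk⇒reflWalk G (proj₁ max) p x0∈H1 xd∈Hd))

  distinct< : ∀ i j → 1 ≤ i → j ≤ d → i < j → H i ≢ H j
  distinct< (suc i) j _ j≤d i<j Hi≡Hj
    with cliques (suc i) (s≤s z≤n) (≤-trans (<⇒≤ i<j) j≤d) | cliques j (≤-trans (s≤s z≤n) i<j) j≤d
  ... | max , xi∈Hi , _ | _ , _ , xj∈Hj =
    separated i<j j≤d (proj₁ max) xi∈Hi (subst (x j ∈_) (sym Hi≡Hj) xj∈Hj)

  distinct : ∀ i j → 1 ≤ i → i ≤ d → 1 ≤ j → j ≤ d → i ≢ j → H i ≢ H j
  distinct i j 1≤i i≤d 1≤j j≤d i≢j with <-cmp i j
  ... | tri< i<j _ _ = distinct< i j 1≤i j≤d i<j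
  ... | tri≈ _ i≡j _ = λ _ → i≢j i≡j
  ... | tri> _ _ j<i = λ Hi≡Hj → distinct< j i 1≤j i≤d j<i (sym Hi≡Hj)
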